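{- Let $n,m$ be positive integers with $m \ge n$, and let $P_n \Box P_m$ be the Cartesian product of the paths on $n$ and $m$ vertices (the $n\times m$ grid graph). Then \[Z_{(1)}(P_n \Box P_m) \le 2m-n.\]
   Context: Let $G=(V,E)$ be a finite simple graph. Color-change rule (zero forcing): given a set of colored vertices, a colored vertex with exactly one uncolored neighbor colors ("forces") that neighbor. Leaks: for a set $L\subseteq V$, placing a leak on each $v\in L$ means attaching to $v$ one new pendant vertex (adjacent only to $v$) which is never initially colored; consequently no vertex of $L$ can ever force a vertex of $V$. A set $S\subseteq V$ is an $\ell$-forcing set if for every $L\subseteq V$ with $|L|\le \ell$, starting with exactly the vertices of $S$ colored and repeatedly applying the color-change rule in the graph with leaks on $L$, every vertex of $V$ eventually becomes colored. The $\ell$-forcing number $Z_{(\ell)}(G)$ ($\ell\ge 0$ an integer) is the minimum size of an $\ell$-forcing set; $Z_{(0)}(G)$ is the usual zero forcing number. The Cartesian product $G\Box H$ has vertex set $V(G)\times V(H)$, with $(x,y)\sim(x',y')$ iff ($x=x'$ and $y\sim y'$ in $H$) or ($y=y'$ and $x\sim x'$ in $G$). -}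

module Defs where

open import Data.Nat using (ℕ; suc; _*_; _≤_)
open import Data.Fin using (Fin; toℕ; remQuot)
open import Data.Fin.Subset using (Subset; _∈_; _∉_; ∣_∣)
open import Data.Product using (_×_; _,_; proj₁; proj₂; ∃-syntax)
open import Data.Sum using (_⊎_)
open import Relation.Binary.PropositionalEquality using (_≡_; _≢_)
open import Relation.Nullary using (¬_)

record Graph (N : ℕ) : Set₁ where
  field
    Adj     : Fin N → Fin N → Set
    symAdj  : ∀ {u v} → Adj u v → Adj v u
    irrAdj  : ∀ {u} → ¬ Adj u u
open Graph public

PathAdj : (n : ℕ) → Fin n → Fin n → Set
PathAdj n i j = (toℕ i ≡ suc (toℕ j)) ⊎ (toℕ j ≡ suc (toℕ i))

path-sym : ∀ {n} {i j : Fin n} → PathAdj n i j → PathAdj n j i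
path-sym (Data.Sum.inj₁ p) = Data.Sum.inj₂ p
path-sym (Data.Sum.inj₂ p) = Data.Sum.inj₁ p

n≢1+n : ∀ (k : ℕ) → ¬ (k ≡ suc k)
n≢1+n ℕ.zero ()
n≢1+n (suc k) p = n≢1+n k (Data.Nat.Properties.suc-injective p)
  where import Data.Nat.Properties

path-irr : ∀ {n} {i : Fin n} → ¬ PathAdj n i i
path-irr {i = i} (Data.Sum.inj₁ p) = n≢1+n (toℕ i) p
path-irr {i = i} (Data.Sum.inj₂ p) = n≢1+n (toℕ i) p

Path : (n : ℕ) → Graph n
Path n = record { Adj = PathAdj n ; symAdj = path-sym ; irrAdj = path-irr }

-- Cartesian product G □ H; the vertex (x , y) of V(G) × V(H) is encoded
-- as the element of Fin (N * M) sent to (x , y) by remQuot M (a bijection).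
BoxAdj : ∀ {N M} → Graph N → Graph M → Fin (N * M) → Fin (N * M) → Set
BoxAdj {N} {M} G H a b =
  let x  = proj₁ (remQuot {N} M a) ; y  = proj₂ (remQuot {N} M a)
      x' = proj₁ (remQuot {N} M b) ; y' = proj₂ (remQuot {N} M b)
  in (x ≡ x' × Adj H y y') ⊎ (y ≡ y' × Adj G x x')

box-sym : ∀ {N M} (G : Graph N) (H : Graph M) {a b} →
          BoxAdj G H a b → BoxAdj G H b a
box-sym G H (Data.Sum.inj₁ (e , h)) =
  Data.Sum.inj₁ (Relation.Binary.PropositionalEquality.sym e , symAdj H h)
box-sym G H (Data.Sum.inj₂ (e , g)) =
  Data.Sum.inj₂ (Relation.Binary.PropositionalEquality.sym e , symAdj G g)

box-irr : ∀ {N M} (G : Graph N) (H : Graph M) {a} → ¬ BoxAdj G H a a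
box-irr G H (Data.Sum.inj₁ (_ , h)) = irrAdj H h
box-irr G H (Data.Sum.inj₂ (_ , g)) = irrAdj G g

_□_ : ∀ {N M} → Graph N → Graph M → Graph (N * M)
G □ H = record { Adj = BoxAdj G H ; symAdj = box-sym G H ; irrAdj = box-irr G H }

-- The set of vertices of V that eventually become colored, starting from S
-- colored, with leaks on L: the least set containing S and closed under the
-- color-change rule, where a vertex u ∉ L that is colored forces its
-- neighbor v when all other neighbors of u are colored. (A leaked vertex
-- u ∈ L always has its uncolored pendant as an extra neighbor, so it never
-- forces a vertex of V; the pendants themselves can never force.)
data Colored {N : ℕ} (G : Graph N) (S L : Subset N) : Fin N → Set where
  initial : ∀ {v} → v ∈ S → Colored G S L v
  force   : ∀ {u v} → Colored G S L u → u ∉ L → Adj G u v →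
            (∀ w → Adj G u w → w ≢ v → Colored G S L w) →
            Colored G S L v

IsLForcingSet : ∀ {N} → ℕ → Graph N → Subset N → Set
IsLForcingSet ℓ G S = ∀ (L : Subset _) → ∣ L ∣ ≤ ℓ → ∀ v → Colored G S L v

LForcingNumber≤ : ∀ {N} → ℕ → Graph N → ℕ → Set
LForcingNumber≤ ℓ G k = ∃[ S ] (∣ S ∣ ≤ k × IsLForcingSet ℓ G S)

module Submission where

-- Write n = (a+1) + (b+1) with |a − b| ≤ 1 and colour the first m − (b+1) cells of row a and
-- the first m − (a+1) cells of row a+1: 2m − n cells. Reflecting the rows swaps these two seeded
-- rows, so we may assume the leak (x₀ , y₀) lies in rows 0..a. The leak-free rows below a then
-- fill up: the triangle i + y < m by forcing downwards, the strip y − i ≤ m − n by forcing to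
-- the right, and the rest row by row from the bottom by forcing upwards. Forcing upwards also
-- colours rows 0..a except for the cone |y − y₀| < x₀ − i above the leak, and the cone is swept
-- sideways: to the right if x₀ ≤ y₀, and to the left otherwise, when it stays clear of the last
-- column because x₀ + y₀ < 2a < n ≤ m. For n = 1 the whole row is a 1-forcing set.

open import Defs
open import Data.Nat using (ℕ; zero; suc; pred; _+_; _*_; _∸_; _≤_; _<_; z≤n; s≤s; s≤s⁻¹; z<s; ⌊_/2⌋; ⌈_/2⌉)
open import Data.Nat.Properties
open import Data.Nat.Induction using (<-rec)
open import Data.Fin using (Fin; toℕ; fromℕ<; combine; remQuot) renaming (_≟_ to _≟ᶠ_)
open import Data.Fin.Properties using (remQuot-combine; combine-remQuot; toℕ-fromℕ<; toℕ<n; toℕ-injective)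
open import Data.Fin.Subset using (Subset; _∈_; _∉_; ∣_∣; ⁅_⁆; _∪_; _-_; inside; outside) renaming (⊥ to ∅)
open import Data.Fin.Subset.Properties using (x∈p∪q⁺; x∈⁅x⁆; ∣⁅x⁆∣≡1; ∣⊥∣≡0; ∣p∣≤∣x∷p∣; nonempty?; x∈p⇒∣p-x∣<∣p∣; x∈p∧x≢y⇒x∈p-y)
open import Data.Vec using (_∷_; [])
open import Data.Product using (_×_; _,_; proj₁; proj₂; ∃-syntax)
open import Data.Sum using (inj₁; inj₂)
open import Data.Empty using (⊥-elim)
open import Function using (_∘_; _∘′_)
open import Relation.Binary.PropositionalEquality
open import Relation.Nullary using (¬_; Dec; yes; no)
open import Relation.Nullary.Decidable using (_×-dec_)

n≤1+pred[n] : ∀ n → n ≤ suc (pred n)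
n≤1+pred[n] zero    = z≤n
n≤1+pred[n] (suc n) = ≤-refl

m∸n≡suc[m∸suc[n]] : ∀ {m n} → n < m → m ∸ n ≡ suc (m ∸ suc n)
m∸n≡suc[m∸suc[n]] = +-∸-assoc 1

m∸n+m∸o≡2m∸[o+n] : ∀ {m n o} → n ≤ m → o ≤ m → (m ∸ n) + (m ∸ o) ≡ 2 * m ∸ (o + n)
m∸n+m∸o≡2m∸[o+n] {m} {n} {o} n≤m o≤m = begin
  (m ∸ n) + (m ∸ o)  ≡⟨ sym (+-∸-comm (m ∸ o) n≤m) ⟩
  m + (m ∸ o) ∸ n    ≡⟨ cong (_∸ n) (sym (+-∸-assoc m o≤m)) ⟩
  m + m ∸ o ∸ n      ≡⟨ ∸-+-assoc (m + m) o n ⟩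
  m + m ∸ (o + n)    ≡⟨ cong (λ k → m + k ∸ (o + n)) (sym (+-identityʳ m)) ⟩
  2 * m ∸ (o + n)    ∎
  where open ≡-Reasoning

measure-ind : (μ : ℕ → ℕ → ℕ) (P : ℕ → ℕ → Set) →
              (∀ i j → (∀ i′ j′ → μ i′ j′ < μ i j → P i′ j′) → P i j) →
              ∀ i j → P i j
measure-ind μ P step i j =
  <-rec (λ k → ∀ i j → μ i j ≡ k → P i j)
        (λ k ih i j μ≡k → step i j λ i′ j′ lt → ih (subst (μ i′ j′ <_) μ≡k lt) i′ j′ refl)
        (μ i j) i j refl

-- Forcing (i , j) into (i , j + 1) only involves cells of smaller weight.
weight : ℕ → ℕ → ℕ
weight i j = i + 2 * j

weight-< : ∀ {i i′ j j′} → i′ ≤ suc i → j′ ≤ j → weight i′ j′ < weight i (suc j)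
weight-< {i} {i′} {j} {j′} i′≤1+i j′≤j = begin-strict
  i′ + 2 * j′            ≤⟨ +-mono-≤ i′≤1+i (*-monoʳ-≤ 2 j′≤j) ⟩
  suc i + 2 * j          <⟨ n<1+n _ ⟩
  suc (suc i + 2 * j)    ≡⟨ cong suc (sym (+-suc i _)) ⟩
  suc (i + suc (2 * j))  ≡⟨ sym (+-suc i _) ⟩
  i + (2 + 2 * j)        ≡⟨ cong (i +_) (sym (*-suc 2 j)) ⟩
  i + 2 * suc j          ∎
  where open ≤-Reasoning

∣p∪q∣≤∣p∣+∣q∣ : ∀ {N} (p q : Subset N) → ∣ p ∪ q ∣ ≤ ∣ p ∣ + ∣ q ∣
∣p∪q∣≤∣p∣+∣q∣ []            []            = z≤n
∣p∪q∣≤∣p∣+∣q∣ (inside  ∷ p) (t       ∷ q) =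
  s≤s (≤-trans (∣p∪q∣≤∣p∣+∣q∣ p q) (+-monoʳ-≤ ∣ p ∣ (∣p∣≤∣x∷p∣ t q)))
∣p∪q∣≤∣p∣+∣q∣ (outside ∷ p) (inside  ∷ q) =
  subst (suc ∣ p ∪ q ∣ ≤_) (sym (+-suc ∣ p ∣ ∣ q ∣)) (s≤s (∣p∪q∣≤∣p∣+∣q∣ p q))
∣p∪q∣≤∣p∣+∣q∣ (outside ∷ p) (outside ∷ q) = ∣p∪q∣≤∣p∣+∣q∣ p q

∣p∣≤1∧x∈p∧y∈p⇒x≡y : ∀ {N} {p : Subset N} {x y} → ∣ p ∣ ≤ 1 → x ∈ p → y ∈ p → x ≡ y
∣p∣≤1∧x∈p∧y∈p⇒x≡y {p = p} {x} {y} ∣p∣≤1 x∈p y∈p with y ≟ᶠ x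
... | yes y≡x = sym y≡x
... | no y≢x = ⊥-elim (1+n≰n (≤-trans (≤-trans (s≤s 1≤∣p-x∣) (x∈p⇒∣p-x∣<∣p∣ x∈p)) ∣p∣≤1))
  where
  1≤∣p-x∣ : 1 ≤ ∣ p - x ∣
  1≤∣p-x∣ = ≤-trans (s≤s z≤n) (x∈p⇒∣p-x∣<∣p∣ (x∈p∧x≢y⇒x∈p-y y∈p y≢x))

data Neighbour (i j : ℕ) : ℕ → ℕ → Set where
  up    : 0 < i → Neighbour i j (pred i) j
  down  : Neighbour i j (suc i) j
  left  : 0 < j → Neighbour i j i (pred j)
  right : Neighbour i j i (suc j)

ForcingClosed : (n m : ℕ) → (ℕ → ℕ → Set) → ℕ × ℕ → Set
ForcingClosed n m Col leak = ∀ {i j p q} → i < n → j < m → p < n → q < m →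
  (i , j) ≢ leak → Neighbour i j p q → Col i j →
  (∀ {p′ q′} → p′ < n → q′ < m → Neighbour i j p′ q′ → (p′ , q′) ≢ (p , q) → Col p′ q′) →
  Col p q

-- Vacuous outside the grid, so hypotheses about neighbours beyond the last row or column are free.
Filled : ℕ → ℕ → (ℕ → ℕ → Set) → ℕ → ℕ → Set
Filled n m Col i j = i < n → j < m → Col i j

module Spread {n m Col x₀ y₀} (closed : ForcingClosed n m Col (x₀ , y₀)) where

  private
    F : ℕ → ℕ → Set
    F = Filled n m Col

  forced : ∀ {i j p q} → i < n → j < m → (i , j) ≢ (x₀ , y₀) → Neighbour i j p q → F i j →
          (∀ {p′ q′} → Neighbour i j p′ q′ → (p′ , q′) ≢ (p , q) → F p′ q′) → F p q
  forced i<n j<m ¬leak nb col others p<n q<m =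
    closed i<n j<m p<n q<m ¬leak nb (col i<n j<m) λ p′<n q′<m nb′ ne → others nb′ ne p′<n q′<m

  -- In the first row or column the hypothesis on the `pred` neighbour is about the cell itself.
  force↓ : ∀ {i j} → (i , j) ≢ (x₀ , y₀) → F i j →
           F (pred i) j → F i (pred j) → F i (suc j) → F (suc i) j
  force↓ ¬leak col col↑ col← col→ 1+i<n j<m =
    forced (<-trans (n<1+n _) 1+i<n) j<m ¬leak down col
      (λ where (up _) _ → col↑
               down ne → ⊥-elim (ne refl)
               (left _) _ → col←
               right _ → col→)
      1+i<n j<m

  force↑ : ∀ {i j} → suc i < n → (suc i , j) ≢ (x₀ , y₀) → F (suc i) j →
           F (suc (suc i)) j → F (suc i) (pred j) → F (suc i) (suc j) → F i j
  force↑ 1+i<n ¬leak col col↓ col← col→ _ j<m =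
    forced 1+i<n j<m ¬leak (up z<s) col
      (λ where (up _) ne → ⊥-elim (ne refl)
               down _ → col↓
               (left _) _ → col←
               right _ → col→)
      (<-trans (n<1+n _) 1+i<n) j<m

  force→ : ∀ {i j} → (i , j) ≢ (x₀ , y₀) → F i j →
           F (pred i) j → F (suc i) j → F i (pred j) → F i (suc j)
  force→ ¬leak col col↑ col↓ col← i<n 1+j<m =
    forced i<n (<-trans (n<1+n _) 1+j<m) ¬leak right col
      (λ where (up _) _ → col↑
               down _ → col↓
               (left _) _ → col←
               right ne → ⊥-elim (ne refl))
      i<n 1+j<m

  force← : ∀ {i j} → suc j < m → (i , suc j) ≢ (x₀ , y₀) → F i (suc j) →
           F (pred i) (suc j) → F (suc i) (suc j) → F i (suc (suc j)) → F i j
  force← 1+j<m ¬leak col col↑ col↓ col→ i<n _ =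
    forced i<n 1+j<m ¬leak (left z<s) col
      (λ where (up _) _ → col↑
               down _ → col↓
               (left _) ne → ⊥-elim (ne refl)
               right _ → col→)
      i<n (<-trans (n<1+n _) 1+j<m)

  above-leak : ∀ {i y} → i < x₀ → (i , y) ≢ (x₀ , y₀)
  above-leak i<x₀ eq = <-irrefl (cong proj₁ eq) i<x₀

  -- The cells with |y − y₀| < x₀ − i: those that forcing upwards cannot reach past the leak.
  Cone : ℕ → ℕ → Set
  Cone i y = i < x₀ × y + i < x₀ + y₀ × y₀ + i < x₀ + y

  cone? : ∀ i y → Dec (Cone i y)
  cone? i y = i <? x₀ ×-dec y + i <? x₀ + y₀ ×-dec y₀ + i <? x₀ + y

  cone-upward : ∀ {i y y′} → Cone (suc i) y′ → y ≤ suc y′ → y′ ≤ suc y → Cone i y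
  cone-upward {i} {y} {y′} (1+i<x₀ , l , r) y≤1+y′ y′≤1+y =
      <-trans (n<1+n i) 1+i<x₀
    , ≤-<-trans (+-monoˡ-≤ i y≤1+y′) (subst (_< x₀ + y₀) (+-suc y′ i) l)
    , s≤s⁻¹ (subst (suc (suc (y₀ + i)) ≤_) (+-suc x₀ y)
        (≤-trans (subst (_< x₀ + y′) (+-suc y₀ i) r) (+-monoʳ-≤ x₀ y′≤1+y)))

  leak-in-cone : ∀ {i y} → (suc i , y) ≡ (x₀ , y₀) → Cone i y
  leak-in-cone {i} {y} eq =
      subst (i <_) (cong proj₁ eq) (n<1+n i)
    , subst₂ (λ x z → y + i < x + z) (cong proj₁ eq) (cong proj₂ eq) y+i<1+i+y
    , subst₂ (λ z x → z + i < x + y) (cong proj₂ eq) (cong proj₁ eq) y+i<1+i+y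
    where
    y+i<1+i+y : y + i < suc i + y
    y+i<1+i+y = s≤s (≤-reflexive (+-comm y i))

  module LeakAbove {a b} (n≡ : n ≡ suc a + suc b) (b≤1+a : b ≤ suc a) (a≤1+b : a ≤ suc b)
                   (n≤m : n ≤ m) (x₀≤a : x₀ ≤ a)
                   (seed-a : ∀ {y} → y + suc b < m → F a y)
                   (seed-1+a : ∀ {y} → y + suc a < m → F (suc a) y) where

    below-leak : ∀ {i y} → a < i → (i , y) ≢ (x₀ , y₀)
    below-leak a<i eq = <⇒≱ a<i (subst (_≤ a) (sym (cong proj₁ eq)) x₀≤a)

    1+a<n : suc a < n
    1+a<n = subst (suc a <_) (sym n≡) (m<m+n (suc a) z<s)

    triangle : ∀ i {y} → a < i → i + y < m → F i y
    row-above : ∀ i {y} → a < i → suc i + y < m → F (pred i) y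

    triangle (suc i) {y} a<1+i 1+i+y<m with m≤n⇒m<n∨m≡n (s≤s⁻¹ a<1+i)
    ... | inj₂ refl = seed-1+a (subst (_< m) (+-comm (suc a) y) 1+i+y<m)
    ... | inj₁ a<i = force↓ (below-leak a<i) (triangle i a<i i+y<m) (row-above i a<i 1+i+y<m)
                       (triangle i a<i (≤-<-trans (+-monoʳ-≤ i pred[n]≤n) i+y<m))
                       (triangle i a<i (subst (_< m) (sym (+-suc i y)) 1+i+y<m))
      where
      i+y<m : i + y < m
      i+y<m = <-trans (n<1+n _) 1+i+y<m

    row-above (suc i) {y} a<1+i 2+i+y<m with m≤n⇒m<n∨m≡n (s≤s⁻¹ a<1+i)
    ... | inj₂ refl = seed-a (≤-<-trans (+-monoʳ-≤ y (s≤s b≤1+a))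
                               (subst (_< m) (+-comm (suc (suc a)) y) 2+i+y<m))
    ... | inj₁ a<i = triangle i a<i (≤-<-trans (m≤n+m _ 2) 2+i+y<m)

    seed-a-reached : ∀ {y} → suc y + n ≤ m + suc a → y + suc b < m
    seed-a-reached {y} h = +-cancelʳ-≤ (suc a) (suc y + suc b) m (subst (_≤ m + suc a) shuffle h)
      where
      shuffle : suc y + n ≡ suc y + suc b + suc a
      shuffle = trans (cong (suc y +_) (trans n≡ (+-comm (suc a) (suc b))))
                      (sym (+-assoc (suc y) (suc b) (suc a)))

    strip : ∀ i y → a < i → y + n ≤ m + i → F i y
    strip = measure-ind weight (λ i y → a < i → y + n ≤ m + i → F i y) step
      where
      step : ∀ i y →
             (∀ i′ y′ → weight i′ y′ < weight i y → a < i′ → y′ + n ≤ m + i′ → F i′ y′) →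
             a < i → y + n ≤ m + i → F i y
      step i y ih a<i _ i<n y<m with i + y <? m
      ... | yes i+y<m = triangle i a<i i+y<m i<n y<m
      step i zero ih a<i _ i<n _ | no i+0≮m =
        ⊥-elim (i+0≮m (subst (_< m) (sym (+-identityʳ i)) (<-≤-trans i<n n≤m)))
      step (suc i) (suc y) ih a<1+i 1+y+n≤ 1+i<n 1+y<m | no _ =
        force→ (below-leak a<1+i) (earlier (n≤1+n _) ≤-refl a<1+i y+n≤) above
          (earlier ≤-refl ≤-refl (<-trans a<1+i (n<1+n _)) (≤-trans y+n≤ (+-monoʳ-≤ m (n≤1+n _))))
          (earlier (n≤1+n _) pred[n]≤n a<1+i (≤-trans (+-monoˡ-≤ n pred[n]≤n) y+n≤))
          1+i<n 1+y<m
        where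
        earlier : ∀ {i′ y′} → i′ ≤ suc (suc i) → y′ ≤ y → a < i′ → y′ + n ≤ m + i′ → F i′ y′
        earlier {i′} {y′} i′≤ y′≤ = ih i′ y′ (weight-< i′≤ y′≤)
        y+n≤ : y + n ≤ m + suc i
        y+n≤ = ≤-trans (n≤1+n _) 1+y+n≤
        above : F i y
        above with m≤n⇒m<n∨m≡n (s≤s⁻¹ a<1+i)
        ... | inj₂ refl = seed-a (seed-a-reached 1+y+n≤)
        ... | inj₁ a<i = earlier (m≤n+m i 2) ≤-refl a<i
                           (s≤s⁻¹ (subst (suc y + n ≤_) (+-suc m i) 1+y+n≤))

    next-row : ∀ {i y} → ¬ (a < i × y + n ≤ m + i) → y < m → suc i < n
    next-row {i} {y} ¬strip y<m with a <? i
    ... | no a≮i = ≤-<-trans (s≤s (≮⇒≥ a≮i)) 1+a<n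
    ... | yes a<i = +-cancelˡ-< m (suc i) n (begin-strict
      m + suc i  ≡⟨ +-suc m i ⟩
      suc (m + i) ≤⟨ ≰⇒> (λ h → ¬strip (a<i , h)) ⟩
      y + n      <⟨ +-monoˡ-< n y<m ⟩
      m + n      ∎)
      where open ≤-Reasoning

    outside-cone : ∀ i y → ¬ Cone i y → F i y
    outside-cone = measure-ind (λ i _ → n ∸ i) (λ i y → ¬ Cone i y → F i y) step
      where
      step : ∀ i y → (∀ i′ y′ → n ∸ i′ < n ∸ i → ¬ Cone i′ y′ → F i′ y′) → ¬ Cone i y → F i y
      step i y ih ¬cone i<n y<m with a <? i ×-dec y + n ≤? m + i
      ... | yes (a<i , h) = strip i y a<i h i<n y<m
      ... | no ¬strip =
        force↑ 1+i<n (¬cone ∘ leak-in-cone)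
          (ih (suc i) y next (¬cone-below (n≤1+n y) (n≤1+n y)))
          (ih (suc (suc i)) y (∸-monoʳ-< (m<n+m i z<s) 1+i<n)
              (¬cone-below (n≤1+n y) (n≤1+n y) ∘ λ c → cone-upward c (n≤1+n y) (n≤1+n y)))
          (ih (suc i) (pred y) next (¬cone-below (n≤1+pred[n] y) (≤-trans pred[n]≤n (n≤1+n y))))
          (ih (suc i) (suc y) next (¬cone-below (m≤n+m y 2) ≤-refl))
          i<n y<m
        where
        1+i<n : suc i < n
        1+i<n = next-row ¬strip y<m
        next : n ∸ suc i < n ∸ i
        next = ∸-monoʳ-< (n<1+n i) i<n
        ¬cone-below : ∀ {y′} → y ≤ suc y′ → y′ ≤ suc y → ¬ Cone (suc i) y′
        ¬cone-below y≤1+y′ y′≤1+y c = ¬cone (cone-upward c y≤1+y′ y′≤1+y)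

    x₀+y₀<m : y₀ < x₀ → x₀ + y₀ < m
    x₀+y₀<m y₀<x₀ = begin-strict
      x₀ + y₀        <⟨ +-monoʳ-< x₀ y₀<x₀ ⟩
      x₀ + x₀        ≤⟨ +-mono-≤ x₀≤a (≤-trans x₀≤a a≤1+b) ⟩
      a + suc b      <⟨ n<1+n _ ⟩
      suc a + suc b  ≡⟨ sym n≡ ⟩
      n              ≤⟨ n≤m ⟩
      m              ∎
      where open ≤-Reasoning

    filled : ∀ i y → F i y
    filled with x₀ ≤? y₀
    ... | yes x₀≤y₀ = measure-ind weight F sweep-right
      where
      sweep-right : ∀ i y → (∀ i′ y′ → weight i′ y′ < weight i y → F i′ y′) → F i y
      sweep-right i y ih with cone? i y
      ... | no ¬cone = outside-cone i y ¬cone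
      sweep-right i zero ih | yes (_ , _ , y₀+i<x₀+0) =
        ⊥-elim (<⇒≱ y₀+i<x₀+0
          (≤-trans (≤-reflexive (+-identityʳ x₀)) (≤-trans x₀≤y₀ (m≤m+n y₀ i))))
      sweep-right i (suc y) ih | yes (i<x₀ , _) =
        force→ (above-leak i<x₀) (earlier (n≤1+n i) ≤-refl)
          (earlier (≤-trans pred[n]≤n (n≤1+n i)) ≤-refl) (earlier ≤-refl ≤-refl)
          (earlier (n≤1+n i) pred[n]≤n)
        where
        earlier : ∀ {i′ y′} → i′ ≤ suc i → y′ ≤ y → F i′ y′
        earlier {i′} {y′} i′≤ y′≤ = ih i′ y′ (weight-< i′≤ y′≤)
    ... | no x₀≰y₀ = measure-ind (λ i y → weight i (m ∸ y)) F sweep-left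
      where
      sweep-left : ∀ i y → (∀ i′ y′ → weight i′ (m ∸ y′) < weight i (m ∸ y) → F i′ y′) → F i y
      sweep-left i y ih with cone? i y
      ... | no ¬cone = outside-cone i y ¬cone
      ... | yes (i<x₀ , y+i<x₀+y₀ , _) =
        force← 1+y<m (above-leak i<x₀) (later (n≤1+n i) ≤-refl)
          (later (≤-trans pred[n]≤n (n≤1+n i)) ≤-refl) (later ≤-refl ≤-refl)
          (later (n≤1+n i) (n≤1+n _))
        where
        1+y<m : suc y < m
        1+y<m = ≤-<-trans (≤-trans (s≤s (m≤m+n y i)) y+i<x₀+y₀) (x₀+y₀<m (≰⇒> x₀≰y₀))
        later : ∀ {i′ y′} → i′ ≤ suc i → suc y ≤ y′ → F i′ y′
        later {i′} {y′} i′≤ 1+y≤y′ =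
          ih i′ y′ (subst (weight i′ (m ∸ y′) <_)
                          (cong (weight i) (sym (m∸n≡suc[m∸suc[n]] (<-trans (n<1+n y) 1+y<m))))
                          (weight-< i′≤ (∸-monoʳ-≤ m 1+y≤y′)))

mirror : ℕ → ℕ → ℕ
mirror n i = n ∸ suc i

mirror-< : ∀ {n i} → i < n → mirror n i < n
mirror-< {suc n} {i} _ = s≤s (m∸n≤m n i)

mirror-mirror : ∀ {n i} → i < n → mirror n (mirror n i) ≡ i
mirror-mirror {suc n} i<n = m∸[m∸n]≡n (s≤s⁻¹ i<n)

mirror-+ : ∀ {n a b} → n ≡ suc a + b → mirror n a ≡ b
mirror-+ {a = a} {b} refl = m+n∸m≡n (suc a) b

mirror-swap : ∀ {n a c} {b d : ℕ} → a < n → (mirror n a , b) ≡ (c , d) → (a , b) ≡ (mirror n c , d)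
mirror-swap {n} a<n eq =
  cong₂ _,_ (trans (sym (mirror-mirror a<n)) (cong (mirror n) (cong proj₁ eq))) (cong proj₂ eq)

Neighbour-mirror : ∀ {n i j p q} → i < n → p < n → Neighbour i j p q →
                   Neighbour (mirror n i) j (mirror n p) q
Neighbour-mirror {n} {suc i} {j} i<n _ (up _) =
  subst (λ p → Neighbour (mirror n (suc i)) j p j) (sym (m∸n≡suc[m∸suc[n]] i<n)) down
Neighbour-mirror {n} {i} {j} _ 1+i<n down =
  subst (λ s → Neighbour s j (mirror n (suc i)) j) (sym (m∸n≡suc[m∸suc[n]] 1+i<n)) (up z<s)
Neighbour-mirror _ _ (left 0<j) = left 0<j
Neighbour-mirror _ _ right = right

closed-mirror : ∀ {n m Col x₀ y₀} → ForcingClosed n m Col (x₀ , y₀) →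
                ForcingClosed n m (Col ∘′ mirror n) (mirror n x₀ , y₀)
closed-mirror {n} {m} {Col} closed {i} {j} {p} {q} i<n j<m p<n q<m ¬leak nb col others =
  closed (mirror-< i<n) j<m (mirror-< p<n) q<m (¬leak ∘ mirror-swap i<n)
    (Neighbour-mirror i<n p<n nb) col others′
  where
  others′ : ∀ {p′ q′} → p′ < n → q′ < m → Neighbour (mirror n i) j p′ q′ →
            (p′ , q′) ≢ (mirror n p , q) → Col p′ q′
  others′ {p′} {q′} p′<n q′<m nb′ ne =
    subst (λ r → Col r q′) (mirror-mirror p′<n)
      (others (mirror-< p′<n) q′<m
         (subst (λ s → Neighbour s j (mirror n p′) q′) (mirror-mirror i<n)
            (Neighbour-mirror (mirror-< i<n) p′<n nb′))
         (ne ∘ mirror-swap p′<n))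

mirror-filled : ∀ {n m Col i k y} → mirror n i ≡ k → Filled n m Col k y → Filled n m (Col ∘′ mirror n) i y
mirror-filled {n} {m} {Col} {y = y} eq col i<n y<m =
  subst (λ r → Filled n m Col r y) (sym eq) col (mirror-< i<n) y<m

filled-everywhere : ∀ {n m Col x₀ y₀ a b} → ForcingClosed n m Col (x₀ , y₀) →
  n ≡ suc a + suc b → b ≤ suc a → a ≤ suc b → n ≤ m →
  (∀ {y} → y + suc b < m → Filled n m Col a y) →
  (∀ {y} → y + suc a < m → Filled n m Col (suc a) y) →
  ∀ i j → Filled n m Col i j
filled-everywhere {n} {m} {Col} {x₀} {a = a} {b} closed n≡ b≤1+a a≤1+b n≤m seed-a seed-1+a
  with x₀ ≤? a
... | yes x₀≤a = LeakAbove.filled n≡ b≤1+a a≤1+b n≤m x₀≤a seed-a seed-1+a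
  where open Spread closed
... | no x₀≰a = λ i j i<n j<m →
  subst (λ r → Col r j) (mirror-mirror i<n)
    (LeakAbove.filled n≡′ a≤1+b b≤1+a n≤m x₀′≤b
       (mirror-filled {Col = Col} (mirror-+ n≡′) ∘ seed-1+a)
       (mirror-filled {Col = Col} (mirror-+ (trans n≡′ (cong suc (+-suc b a)))) ∘ seed-a)
       (mirror n i) j (mirror-< i<n) j<m)
  where
  open Spread (closed-mirror closed)
  n≡′ : n ≡ suc b + suc a
  n≡′ = trans n≡ (+-comm (suc a) (suc b))
  x₀′≤b : mirror n x₀ ≤ b
  x₀′≤b = ≤-trans (∸-monoʳ-≤ n (s≤s (≰⇒> x₀≰a)))
                  (≤-reflexive (mirror-+ (trans n≡ (cong suc (+-suc a b)))))

module Grid (n m : ℕ) where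

  G : Graph (n * m)
  G = Path n □ Path m

  row col : Fin (n * m) → ℕ
  row w = toℕ (proj₁ (remQuot {n} m w))
  col w = toℕ (proj₂ (remQuot {n} m w))

  row<n : ∀ w → row w < n
  row<n w = toℕ<n _

  col<m : ∀ w → col w < m
  col<m w = toℕ<n _

  cell : ∀ {i j} → i < n → j < m → Fin (n * m)
  cell i<n j<m = combine (fromℕ< i<n) (fromℕ< j<m)

  row-cell : ∀ {i j} (i<n : i < n) (j<m : j < m) → row (cell i<n j<m) ≡ i
  row-cell i<n j<m =
    trans (cong (toℕ ∘ proj₁) (remQuot-combine (fromℕ< i<n) (fromℕ< j<m))) (toℕ-fromℕ< i<n)

  col-cell : ∀ {i j} (i<n : i < n) (j<m : j < m) → col (cell i<n j<m) ≡ j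
  col-cell i<n j<m =
    trans (cong (toℕ ∘ proj₂) (remQuot-combine (fromℕ< i<n) (fromℕ< j<m))) (toℕ-fromℕ< j<m)

  coords-injective : ∀ {v w} → row v ≡ row w → col v ≡ col w → v ≡ w
  coords-injective {v} {w} r c = begin
    v                                                            ≡⟨ sym (combine-remQuot {n} m v) ⟩
    combine (proj₁ (remQuot {n} m v)) (proj₂ (remQuot {n} m v))
      ≡⟨ cong₂ combine (toℕ-injective r) (toℕ-injective c) ⟩
    combine (proj₁ (remQuot {n} m w)) (proj₂ (remQuot {n} m w))  ≡⟨ combine-remQuot {n} m w ⟩
    w                                                            ∎
    where open ≡-Reasoning

  adjacent⇒Neighbour : ∀ {u w} → Adj G u w → Neighbour (row u) (col u) (row w) (col w)
  adjacent⇒Neighbour {u} (inj₁ (e , inj₁ c)) =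
    subst₂ (Neighbour (row u) (col u)) (cong toℕ e) (cong pred c) (left (subst (0 <_) (sym c) z<s))
  adjacent⇒Neighbour {u} (inj₁ (e , inj₂ c)) =
    subst₂ (Neighbour (row u) (col u)) (cong toℕ e) (sym c) right
  adjacent⇒Neighbour {u} (inj₂ (e , inj₁ r)) =
    subst₂ (Neighbour (row u) (col u)) (cong pred r) (cong toℕ e) (up (subst (0 <_) (sym r) z<s))
  adjacent⇒Neighbour {u} (inj₂ (e , inj₂ r)) =
    subst₂ (Neighbour (row u) (col u)) (sym r) (cong toℕ e) down

  Neighbour⇒adjacent : ∀ {u w i j p q} → Neighbour i j p q →
                       row u ≡ i → col u ≡ j → row w ≡ p → col w ≡ q → Adj G u w
  Neighbour⇒adjacent {i = suc i} (up _) ru cu rw cw =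
    inj₂ (toℕ-injective (trans cu (sym cw)) , inj₁ (trans ru (cong suc (sym rw))))
  Neighbour⇒adjacent down ru cu rw cw =
    inj₂ (toℕ-injective (trans cu (sym cw)) , inj₂ (trans rw (cong suc (sym ru))))
  Neighbour⇒adjacent {j = suc j} (left _) ru cu rw cw =
    inj₁ (toℕ-injective (trans ru (sym rw)) , inj₁ (trans cu (cong suc (sym cw))))
  Neighbour⇒adjacent right ru cu rw cw =
    inj₁ (toℕ-injective (trans ru (sym rw)) , inj₂ (trans cw (cong suc (sym cu))))

  ColoredAt : Subset (n * m) → Subset (n * m) → ℕ → ℕ → Set
  ColoredAt S L i j = ∀ {w} → row w ≡ i → col w ≡ j → Colored G S L w

  coloredAt-closed : ∀ {S L ℓ} → (∀ {w} → (row w , col w) ≢ ℓ → w ∉ L) →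
                     ForcingClosed n m (ColoredAt S L) ℓ
  coloredAt-closed unleaked {i} {j} i<n j<m _ _ ¬leak nb source others rw cw =
    force (source ru cu) (unleaked (¬leak ∘ trans (sym (cong₂ _,_ ru cu))))
      (Neighbour⇒adjacent nb ru cu rw cw)
      λ v adj v≢w → others (row<n v) (col<m v)
        (subst₂ (λ r c → Neighbour r c (row v) (col v)) ru cu (adjacent⇒Neighbour adj))
        (λ eq → v≢w (coords-injective (trans (cong proj₁ eq) (sym rw))
                                      (trans (cong proj₂ eq) (sym cw))))
        refl refl
    where
    ru : row (cell i<n j<m) ≡ i
    ru = row-cell i<n j<m
    cu : col (cell i<n j<m) ≡ j
    cu = col-cell i<n j<m

  leak-position : ∀ {L} → ∣ L ∣ ≤ 1 → ∃[ ℓ ] (∀ {w} → (row w , col w) ≢ ℓ → w ∉ L)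
  leak-position {L} ∣L∣≤1 with nonempty? L
  ... | yes (v , v∈L) =
    (row v , col v) , λ ne w∈L → ne (cong (λ u → row u , col u) (∣p∣≤1∧x∈p∧y∈p⇒x≡y ∣L∣≤1 w∈L v∈L))
  ... | no L-empty = (0 , 0) , λ _ w∈L → L-empty (_ , w∈L)

  segment : ∀ {r} → r < n → (k : ℕ) → k ≤ m → Subset (n * m)
  segment r<n zero    _     = ∅
  segment r<n (suc k) 1+k≤m = ⁅ cell r<n 1+k≤m ⁆ ∪ segment r<n k (≤-trans (n≤1+n k) 1+k≤m)

  ∣segment∣≤ : ∀ {r} (r<n : r < n) k (k≤m : k ≤ m) → ∣ segment r<n k k≤m ∣ ≤ k
  ∣segment∣≤ r<n zero    _     = ≤-reflexive (∣⊥∣≡0 (n * m))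
  ∣segment∣≤ r<n (suc k) 1+k≤m = ≤-trans (∣p∪q∣≤∣p∣+∣q∣ ⁅ cell r<n 1+k≤m ⁆ (segment r<n k k≤m))
    (+-mono-≤ (≤-reflexive (∣⁅x⁆∣≡1 (cell r<n 1+k≤m))) (∣segment∣≤ r<n k k≤m))
    where
    k≤m : k ≤ m
    k≤m = ≤-trans (n≤1+n k) 1+k≤m

  ∈-segment : ∀ {r w} (r<n : r < n) k (k≤m : k ≤ m) → row w ≡ r → col w < k → w ∈ segment r<n k k≤m
  ∈-segment {w = w} r<n (suc k) 1+k≤m rw cw<1+k with col w ≟ k
  ... | yes cw≡k = x∈p∪q⁺ (inj₁ (subst (_∈ ⁅ cell r<n 1+k≤m ⁆)
          (coords-injective (trans (row-cell r<n 1+k≤m) (sym rw))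
                            (trans (col-cell r<n 1+k≤m) (sym cw≡k)))
          (x∈⁅x⁆ _)))
  ... | no cw≢k = x∈p∪q⁺ (inj₂ (∈-segment r<n k _ rw (≤∧≢⇒< (s≤s⁻¹ cw<1+k) cw≢k)))

  two-rows-forcing : ∀ {a b} → n ≡ suc a + suc b → b ≤ suc a → a ≤ suc b → n ≤ m →
                     LForcingNumber≤ 1 G (2 * m ∸ n)
  two-rows-forcing {a} {b} n≡ b≤1+a a≤1+b n≤m = S , ∣S∣≤ , forcing
    where
    1+a<n : suc a < n
    1+a<n = subst (suc a <_) (sym n≡) (m<m+n (suc a) z<s)
    a<n : a < n
    a<n = <-trans (n<1+n a) 1+a<n
    upper lower : Subset (n * m)
    upper = segment a<n (m ∸ suc b) (m∸n≤m m (suc b))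
    lower = segment 1+a<n (m ∸ suc a) (m∸n≤m m (suc a))
    1+b≤m : suc b ≤ m
    1+b≤m = ≤-trans (m≤n+m (suc b) (suc a)) (≤-trans (≤-reflexive (sym n≡)) n≤m)
    S : Subset (n * m)
    S = upper ∪ lower
    ∣S∣≤ : ∣ S ∣ ≤ 2 * m ∸ n
    ∣S∣≤ = begin
      ∣ upper ∪ lower ∣            ≤⟨ ∣p∪q∣≤∣p∣+∣q∣ upper lower ⟩
      ∣ upper ∣ + ∣ lower ∣         ≤⟨ +-mono-≤ (∣segment∣≤ a<n (m ∸ suc b) (m∸n≤m m (suc b)))
                                               (∣segment∣≤ 1+a<n (m ∸ suc a) (m∸n≤m m (suc a))) ⟩
      (m ∸ suc b) + (m ∸ suc a)    ≡⟨ m∸n+m∸o≡2m∸[o+n] 1+b≤m (≤-trans (<⇒≤ 1+a<n) n≤m) ⟩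
      2 * m ∸ (suc a + suc b)      ≡⟨ cong (2 * m ∸_) (sym n≡) ⟩
      2 * m ∸ n                    ∎
      where open ≤-Reasoning
    forcing : IsLForcingSet 1 G S
    forcing L ∣L∣≤1 w with leak-position ∣L∣≤1
    ... | _ , unleaked =
      filled-everywhere (coloredAt-closed unleaked) n≡ b≤1+a a≤1+b n≤m seed-a seed-1+a
        (row w) (col w) (row<n w) (col<m w) refl refl
      where
      seed-a : ∀ {y} → y + suc b < m → Filled n m (ColoredAt S L) a y
      seed-a {y} h _ _ rv cv = initial (x∈p∪q⁺ (inj₁ (∈-segment a<n _ _ rv
        (subst (_< m ∸ suc b) (sym cv) (m+n≤o⇒m≤o∸n (suc y) h)))))
      seed-1+a : ∀ {y} → y + suc a < m → Filled n m (ColoredAt S L) (suc a) y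
      seed-1+a {y} h _ _ rv cv = initial (x∈p∪q⁺ (inj₂ (∈-segment 1+a<n _ _ rv
        (subst (_< m ∸ suc a) (sym cv) (m+n≤o⇒m≤o∸n (suc y) h)))))

one-row-forcing : ∀ m → 1 ≤ m → LForcingNumber≤ 1 (Path 1 □ Path m) (2 * m ∸ 1)
one-row-forcing (suc m) _ =
    segment z<s (suc m) ≤-refl
  , ≤-trans (∣segment∣≤ z<s (suc m) ≤-refl)
            (subst (λ k → suc m ≤ m + suc k) (sym (+-identityʳ m)) (m≤n+m (suc m) m))
  , λ _ _ w → initial (∈-segment z<s (suc m) ≤-refl (n<1⇒n≡0 (row<n w)) (col<m w))
  where open Grid 1 (suc m)

theorem27 : ∀ (n m : ℕ) → 1 ≤ n → n ≤ m →
            LForcingNumber≤ 1 (Path n □ Path m) (2 * m ∸ n)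
theorem27 zero          m ()  _
theorem27 (suc zero)    m _ 1≤m = one-row-forcing m 1≤m
theorem27 (suc (suc k)) m _ n≤m =
  Grid.two-rows-forcing (suc (suc k)) m n≡ (⌊n/2⌋-mono (n≤1+n (suc k)))
    (≤-trans (⌊n/2⌋≤⌈n/2⌉ k) (n≤1+n _)) n≤m
  where
  n≡ : suc (suc k) ≡ suc ⌊ k /2⌋ + suc ⌈ k /2⌉
  n≡ = sym (cong suc (trans (+-suc ⌊ k /2⌋ ⌈ k /2⌉) (cong suc (⌊n/2⌋+⌈n/2⌉≡n k))))
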